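{- Let $\mathcal{C}$ be a set of $3$-dimensional subspaces of $V=\mathbb{F}_2^6$ such that $\dim(E\cap E')\le 1$ for all distinct $E,E'\in\mathcal{C}$. If $\#\mathcal{C}\ge 74$, then $\mathcal{C}$ contains a $17$-configuration.
   Context: A $9$-configuration in $\mathcal{C}$ is a subset of $9$ members of $\mathcal{C}$ all containing a common $1$-dimensional subspace $P$ (at most $9$ members of $\mathcal{C}$ can contain a given point). A $17$-configuration in $\mathcal{C}$ is a subset of $\mathcal{C}$ of size $17$ which is the union of two $9$-configurations; equivalently it corresponds to two distinct points $P,P'$ each contained in $9$ members of $\mathcal{C}$ and both contained in a common member of $\mathcal{C}$. -}

module Defs where

open import Data.Bool using (Bool; true; false; _xor_; _∧_; if_then_else_)
open import Data.Nat using (ℕ; zero; suc; _+_; _^_; _≤_)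
open import Data.List using (List; []; _∷_; _++_; map)
open import Data.Vec using (Vec; []; _∷_; zipWith; replicate)
open import Data.Fin using (Fin)
open import Data.Fin.Subset using (Subset; _∈_; _∪_; ∣_∣)
open import Data.Product using (_×_; ∃-syntax)
open import Relation.Binary.PropositionalEquality using (_≡_)

-- The field F₂ is modelled by Bool (addition = xor, multiplication = ∧).
-- The ambient space V = F₂^6.
V : Set
V = Vec Bool 6

_+ᵥ_ : V → V → V
_+ᵥ_ = zipWith _xor_

0ᵥ : V
0ᵥ = replicate 6 false

allVecs : (n : ℕ) → List (Vec Bool n)
allVecs zero    = [] ∷ []
allVecs (suc n) = map (false ∷_) (allVecs n) ++ map (true ∷_) (allVecs n)

SubsetV : Set
SubsetV = V → Bool

_∈V_ : V → SubsetV → Set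
v ∈V S = S v ≡ true

_⊆V_ : SubsetV → SubsetV → Set
S ⊆V T = ∀ v → v ∈V S → v ∈V T

_∩V_ : SubsetV → SubsetV → SubsetV
(S ∩V T) v = S v ∧ T v

countIn : {n : ℕ} → (Vec Bool n → Bool) → List (Vec Bool n) → ℕ
countIn S []       = 0
countIn S (v ∷ vs) = (if S v then 1 else 0) + countIn S vs

card : SubsetV → ℕ
card S = countIn S (allVecs 6)

-- Linear subspace of V over F₂: contains 0 and is closed under addition
-- (closure under scalar multiplication by 0,1 is then automatic).
IsSubspace : SubsetV → Set
IsSubspace S = (0ᵥ ∈V S) × (∀ u v → u ∈V S → v ∈V S → (u +ᵥ v) ∈V S)

-- A subspace W of V over F₂ has dimension d iff #W = 2^d.
HasDim : SubsetV → ℕ → Set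
HasDim S d = card S ≡ 2 ^ d

NineConfig : {n : ℕ} → (Fin n → SubsetV) → Subset n → Set
NineConfig {n} C S =
  (∣ S ∣ ≡ 9) ×
  (∃[ P ] (IsSubspace P × HasDim P 1 × (∀ (i : Fin n) → i ∈ S → P ⊆V C i)))

SeventeenConfig : {n : ℕ} → (Fin n → SubsetV) → Set
SeventeenConfig {n} C =
  ∃[ S ] ∃[ T ] (NineConfig C S × NineConfig C T × (∣ S ∪ T ∣ ≡ 17))

{-# OPTIONS --safe #-}
module Submission where

-- Call the number of members through a nonzero point x its degree. Two members share at most one
-- nonzero point, so the members through a fixed v ≠ 0 cover every point outside {0, v} at most
-- once. Counting incidences inside any K ∋ 0, v gives
--   Σ_{x ∈ K} #{members through v and x} + #{uncovered points of K} + 2 = |K| + 2 deg v.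
-- For K = V the sum is 8 deg v, so 6 deg v + #uncovered = 62: the degree is at most 10, and
-- degree 10 leaves exactly two uncovered points. For a hyperplane K through v avoiding one of
-- them the sum is divisible by 4 (a plane meets a hyperplane in 4 or 8 points), while the identity
-- makes it 49 or 50. So every degree is at most 9, and double counting gives 7n ≤ 8·63 + h for the
-- number h of points of degree 9. If no member contained two of them, also 9h ≤ n, which fails for
-- n ≥ 74. The members through two degree-9 points of a common member form the 17-configuration.

open import Defs
open import Algebra.Bundles using (CommutativeRing)
open import Data.Bool using (Bool; true; false; not; _∧_; _∨_; _xor_; if_then_else_)
import Data.Bool.Properties as Bool
open import Data.Empty using (⊥)
open import Data.Fin using (Fin; zero; suc)
import Data.Fin.Properties as Fin
open import Data.Fin.Subset using (Subset; _∪_; _∩_; ∣_∣) renaming (_∈_ to _∈ₛ_)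
open import Data.List using (List; []; _∷_; _++_; map; length; allFin)
open import Data.List.Membership.Propositional using (_∈_)
open import Data.List.Membership.Propositional.Properties
  using (∈-map⁺; ∈-map⁻; ∈-++⁺ˡ; ∈-++⁺ʳ; ∈-allFin)
open import Data.List.Properties using (map-cong; map-++; map-∘; map-tabulate; length-tabulate)
open import Data.List.Relation.Binary.Disjoint.Propositional using (Disjoint)
open import Data.List.Relation.Unary.All as All using (All; all?)
open import Data.List.Relation.Unary.Any using (Any; here; there; any?; satisfied)
open import Data.List.Relation.Unary.Unique.Propositional using (Unique; _∷_; [])
import Data.List.Relation.Unary.Unique.Propositional.Properties as Unique
open import Data.Nat using (ℕ; zero; suc; _+_; _*_; _^_; _≤_; _<_; z≤n; s≤s; z<s; _≤?_; _<?_)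
open import Data.Nat.Divisibility using (_∣_; _∣?_; divides; ∣m∣n⇒∣m+n; ∣n⇒∣m*n)
open import Data.Nat.ListAction using (sum)
open import Data.Nat.ListAction.Properties using (sum-++)
import Data.Nat.Properties as ℕ
open import Data.Nat.Properties hiding (_≟_)
open import Data.Nat.Tactic.RingSolver using (solve-∀)
open import Data.Product using (_×_; _,_; ∃-syntax; ∃₂; proj₁; proj₂)
open import Data.Sum using (_⊎_; inj₁; inj₂; [_,_]′)
open import Data.Vec as Vec using (Vec; zipWith; replicate)
open import Data.Vec.Properties
  using (≡-dec; ∷-injectiveʳ; zipWith-assoc; zipWith-identityˡ; zipWith-identityʳ;
         lookup∘tabulate; lookup-zipWith; []=⇒lookup)
open import Function using (_∘_; id)
open import Relation.Binary.Definitions using (DecidableEquality)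
open import Relation.Binary.PropositionalEquality
open import Relation.Nullary using (Dec; ¬_; yes; no; does; contradiction)
open import Relation.Nullary.Decidable
  using (_⊎-dec_; _×-dec_; from-yes; from-no; dec-true; decidable-stable)

open import Algebra.Properties.CommutativeSemigroup +-commutativeSemigroup
  using () renaming (interchange to +-interchange)
open import Algebra.Properties.CommutativeSemigroup
  (CommutativeRing.+-commutativeSemigroup Bool.xor-∧-commutativeRing)
  using () renaming (interchange to xor-interchange)

private variable
  A B : Set
  m   : ℕ

-- Indicators and sums over lists

𝟙 : Bool → ℕ
𝟙 b = if b then 1 else 0

0<𝟙⇒true : ∀ {b} → 0 < 𝟙 b → b ≡ true
0<𝟙⇒true {true} _ = refl

true⇒0<𝟙 : ∀ {b} → b ≡ true → 0 < 𝟙 b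
true⇒0<𝟙 refl = ≤-refl

𝟙-∧ : ∀ a b → 𝟙 (a ∧ b) ≡ 𝟙 a * 𝟙 b
𝟙-∧ true  true  = refl
𝟙-∧ true  false = refl
𝟙-∧ false b     = refl

𝟙-split : ∀ a b → 𝟙 a ≡ 𝟙 (a ∧ not b) + 𝟙 (a ∧ b)
𝟙-split false b     = refl
𝟙-split true  false = refl
𝟙-split true  true  = refl

𝟙-*-cong : ∀ b {m k} → (b ≡ true → m ≡ k) → 𝟙 b * m ≡ 𝟙 b * k
𝟙-*-cong true  m≡k = cong (1 *_) (m≡k refl)
𝟙-*-cong false m≡k = refl

does⇒ : ∀ {P : Set} (P? : Dec P) → does P? ≡ true → P
does⇒ (yes p) _ = p

not-does⇒¬ : ∀ {P : Set} (P? : Dec P) → not (does P?) ≡ true → ¬ P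
not-does⇒¬ (no ¬p) _ = ¬p

∑ : List A → (A → ℕ) → ℕ
∑ xs f = sum (map f xs)

infixl 10 ∑
syntax ∑ xs (λ x → e) = ∑[ x ∈ xs ] e

∑-cong : ∀ (xs : List A) {f g : A → ℕ} → (∀ x → f x ≡ g x) → ∑ xs f ≡ ∑ xs g
∑-cong xs f≗g = cong sum (map-cong f≗g xs)

∑-mono-≤ : ∀ (xs : List A) {f g : A → ℕ} → (∀ x → f x ≤ g x) → ∑ xs f ≤ ∑ xs g
∑-mono-≤ []       f≤g = z≤n
∑-mono-≤ (x ∷ xs) f≤g = +-mono-≤ (f≤g x) (∑-mono-≤ xs f≤g)

∑-distrib-+ : ∀ (xs : List A) (f g : A → ℕ) → ∑[ x ∈ xs ] (f x + g x) ≡ ∑ xs f + ∑ xs g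
∑-distrib-+ []       f g = refl
∑-distrib-+ (x ∷ xs) f g =
  trans (cong (f x + g x +_) (∑-distrib-+ xs f g)) (+-interchange (f x) (g x) _ _)

∑-distribˡ-* : ∀ c (xs : List A) (f : A → ℕ) → ∑[ x ∈ xs ] (c * f x) ≡ c * ∑ xs f
∑-distribˡ-* c []       f = sym (*-zeroʳ c)
∑-distribˡ-* c (x ∷ xs) f =
  trans (cong (c * f x +_) (∑-distribˡ-* c xs f)) (sym (*-distribˡ-+ c (f x) _))

∑-const : ∀ (xs : List A) c → ∑[ _ ∈ xs ] c ≡ length xs * c
∑-const []       c = refl
∑-const (x ∷ xs) c = cong (c +_) (∑-const xs c)

∑-++ : ∀ (xs ys : List A) f → ∑ (xs ++ ys) f ≡ ∑ xs f + ∑ ys f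
∑-++ xs ys f = trans (cong sum (map-++ f xs ys)) (sum-++ (map f xs) (map f ys))

∑-map : ∀ (g : B → A) (ys : List B) f → ∑ (map g ys) f ≡ ∑[ y ∈ ys ] f (g y)
∑-map g ys f = cong sum (sym (map-∘ ys))

∑-comm : ∀ (xs : List A) (ys : List B) (f : A → B → ℕ) →
         ∑[ x ∈ xs ] ∑[ y ∈ ys ] f x y ≡ ∑[ y ∈ ys ] ∑[ x ∈ xs ] f x y
∑-comm []       ys f = sym (trans (∑-const ys 0) (*-zeroʳ (length ys)))
∑-comm (x ∷ xs) ys f =
  trans (cong (∑ ys (f x) +_) (∑-comm xs ys f)) (sym (∑-distrib-+ ys (f x) _))

count-split : ∀ (xs : List A) (p q : A → Bool) →
  ∑[ x ∈ xs ] 𝟙 (p x) ≡ ∑[ x ∈ xs ] 𝟙 (p x ∧ not (q x)) + ∑[ x ∈ xs ] 𝟙 (p x ∧ q x)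
count-split xs p q = trans (∑-cong xs (λ x → 𝟙-split (p x) (q x)))
                           (∑-distrib-+ xs (λ x → 𝟙 (p x ∧ not (q x))) (λ x → 𝟙 (p x ∧ q x)))

∑-∣ : ∀ {d} (xs : List A) (f : A → ℕ) → (∀ x → d ∣ f x) → d ∣ ∑ xs f
∑-∣ []       f d∣f = divides 0 refl
∑-∣ (x ∷ xs) f d∣f = ∣m∣n⇒∣m+n (d∣f x) (∑-∣ xs f d∣f)

∈⇒≤∑ : ∀ {xs : List A} {x} (f : A → ℕ) → x ∈ xs → f x ≤ ∑ xs f
∈⇒≤∑ f (here refl)               = m≤m+n _ _
∈⇒≤∑ {xs = y ∷ _} f (there x∈xs) = ≤-trans (∈⇒≤∑ f x∈xs) (m≤n+m _ (f y))

∑-pos⇒∃ : ∀ (xs : List A) {f : A → ℕ} → 0 < ∑ xs f → ∃[ x ] x ∈ xs × 0 < f x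
∑-pos⇒∃ (x ∷ xs) {f} pos with f x in fx
... | suc _ = x , here refl , subst (0 <_) (sym fx) z<s
... | zero  = let y , y∈xs , 0<fy = ∑-pos⇒∃ xs pos in y , there y∈xs , 0<fy

∑-<⇒∃ : ∀ (xs : List A) {f g : A → ℕ} → ∑ xs f < ∑ xs g → ∃[ x ] f x < g x
∑-<⇒∃ (x ∷ xs) {f} {g} ∑f<∑g with f x <? g x | ∑ xs f <? ∑ xs g
... | yes fx<gx | _        = x , fx<gx
... | no  _     | yes rest = ∑-<⇒∃ xs rest
... | no  fx≮gx | no  rest = contradiction ∑f<∑g (≤⇒≯ (+-mono-≤ (≮⇒≥ fx≮gx) (≮⇒≥ rest)))

module _ (p : A → Bool) where

  1<count⇒pair : ∀ {xs} → Unique xs → 1 < ∑[ x ∈ xs ] 𝟙 (p x) →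
                 ∃₂ λ x y → x ≢ y × p x ≡ true × p y ≡ true
  1<count⇒pair {x ∷ xs} (x∉xs ∷ xs!) 1<count with p x in px
  ... | true  = let y , y∈xs , 0<py = ∑-pos⇒∃ xs (≤-pred 1<count)
                in x , y , All.lookup x∉xs y∈xs , px , 0<𝟙⇒true 0<py
  ... | false = 1<count⇒pair xs! 1<count

  count≤1 : ∀ {xs} → Unique xs → (∀ {x y} → p x ≡ true → p y ≡ true → x ≡ y) →
            ∑[ x ∈ xs ] 𝟙 (p x) ≤ 1
  count≤1 xs! p-unique = ≮⇒≥ λ 1<count →
    let x , y , x≢y , px , py = 1<count⇒pair xs! 1<count in x≢y (p-unique px py)

∑-δ : (_≟_ : DecidableEquality A) {xs : List A} {a : A} → Unique xs → a ∈ xs →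
      ∑[ x ∈ xs ] 𝟙 (does (x ≟ a)) ≡ 1
∑-δ _≟_ {xs} {a} xs! a∈xs = ≤-antisym
  (count≤1 (λ x → does (x ≟ a)) xs! λ {x} {y} x≡a y≡a →
    trans (does⇒ (x ≟ a) x≡a) (sym (does⇒ (y ≟ a) y≡a)))
  (subst (_≤ ∑[ x ∈ xs ] 𝟙 (does (x ≟ a))) (cong 𝟙 (dec-true (a ≟ a) refl))
         (∈⇒≤∑ (λ x → 𝟙 (does (x ≟ a))) a∈xs))

-- The cube F₂ᵐ

_≟_ : DecidableEquality (Vec Bool m)
_≟_ = ≡-dec Bool._≟_

∈-allVecs : (x : Vec Bool m) → x ∈ allVecs m
∈-allVecs Vec.[]          = here refl
∈-allVecs (false Vec.∷ x) = ∈-++⁺ˡ (∈-map⁺ (false Vec.∷_) (∈-allVecs x))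
∈-allVecs (true Vec.∷ x)  =
  ∈-++⁺ʳ (map (false Vec.∷_) (allVecs _)) (∈-map⁺ (true Vec.∷_) (∈-allVecs x))

allVecs⁺ : ∀ m → Unique (allVecs m)
allVecs⁺ zero    = All.[] ∷ []
allVecs⁺ (suc m) = Unique.++⁺ (Unique.map⁺ ∷-injectiveʳ (allVecs⁺ m))
                              (Unique.map⁺ ∷-injectiveʳ (allVecs⁺ m)) heads-differ
  where
  heads-differ : Disjoint (map (false Vec.∷_) (allVecs m)) (map (true Vec.∷_) (allVecs m))
  heads-differ (x∈F , x∈T) with ∈-map⁻ (false Vec.∷_) x∈F | ∈-map⁻ (true Vec.∷_) x∈T
  ... | _ , _ , refl | _ , _ , ()

∑-allVecs-suc : ∀ m (f : Vec Bool (suc m) → ℕ) →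
  ∑ (allVecs (suc m)) f ≡ ∑[ x ∈ allVecs m ] f (false Vec.∷ x) + ∑[ x ∈ allVecs m ] f (true Vec.∷ x)
∑-allVecs-suc m f = trans (∑-++ (map (false Vec.∷_) (allVecs m)) _ f)
                          (cong₂ _+_ (∑-map _ (allVecs m) f) (∑-map _ (allVecs m) f))

δ : Vec Bool m → Vec Bool m → ℕ
δ a x = 𝟙 (does (x ≟ a))

∑-δᵥ : (a : Vec Bool m) → ∑[ x ∈ allVecs m ] δ a x ≡ 1
∑-δᵥ a = ∑-δ _≟_ (allVecs⁺ _) (∈-allVecs a)

_⊕_ : Vec Bool m → Vec Bool m → Vec Bool m
_⊕_ = zipWith _xor_

⊕-self : (x : Vec Bool m) → x ⊕ x ≡ replicate m false
⊕-self Vec.[]      = refl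
⊕-self (b Vec.∷ x) = cong₂ Vec._∷_ (Bool.xor-same b) (⊕-self x)

⊕-cancelʳ : (x u : Vec Bool m) → (x ⊕ u) ⊕ u ≡ x
⊕-cancelʳ x u = begin
  (x ⊕ u) ⊕ u            ≡⟨ zipWith-assoc Bool.xor-assoc x u u ⟩
  x ⊕ (u ⊕ u)            ≡⟨ cong (x ⊕_) (⊕-self u) ⟩
  x ⊕ replicate _ false  ≡⟨ zipWith-identityʳ Bool.xor-identityʳ x ⟩
  x                      ∎
  where open ≡-Reasoning

∑-translate : ∀ (u : Vec Bool m) f → ∑ (allVecs m) f ≡ ∑[ x ∈ allVecs m ] f (x ⊕ u)
∑-translate Vec.[] f = refl
∑-translate {suc m} (false Vec.∷ u) f = begin
  ∑ (allVecs (suc m)) f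
    ≡⟨ ∑-allVecs-suc m f ⟩
  ∑[ x ∈ allVecs m ] f (false Vec.∷ x) + ∑[ x ∈ allVecs m ] f (true Vec.∷ x)
    ≡⟨ cong₂ _+_ (∑-translate u _) (∑-translate u _) ⟩
  ∑[ x ∈ allVecs m ] f (false Vec.∷ x ⊕ u) + ∑[ x ∈ allVecs m ] f (true Vec.∷ x ⊕ u)
    ≡⟨ ∑-allVecs-suc m _ ⟨
  ∑[ x ∈ allVecs (suc m) ] f (x ⊕ (false Vec.∷ u))
    ∎
  where open ≡-Reasoning
∑-translate {suc m} (true Vec.∷ u) f = begin
  ∑ (allVecs (suc m)) f
    ≡⟨ ∑-allVecs-suc m f ⟩
  ∑[ x ∈ allVecs m ] f (false Vec.∷ x) + ∑[ x ∈ allVecs m ] f (true Vec.∷ x)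
    ≡⟨ +-comm (∑[ x ∈ allVecs m ] f (false Vec.∷ x)) _ ⟩
  ∑[ x ∈ allVecs m ] f (true Vec.∷ x) + ∑[ x ∈ allVecs m ] f (false Vec.∷ x)
    ≡⟨ cong₂ _+_ (∑-translate u _) (∑-translate u _) ⟩
  ∑[ x ∈ allVecs m ] f (true Vec.∷ x ⊕ u) + ∑[ x ∈ allVecs m ] f (false Vec.∷ x ⊕ u)
    ≡⟨ ∑-allVecs-suc m _ ⟨
  ∑[ x ∈ allVecs (suc m) ] f (x ⊕ (true Vec.∷ u))
    ∎
  where open ≡-Reasoning

_·_ : Vec Bool m → Vec Bool m → Bool
Vec.[]       · Vec.[]       = false
(a Vec.∷ as) · (x Vec.∷ xs) = (a ∧ x) xor (as · xs)

·-zeroʳ : (a : Vec Bool m) → a · replicate m false ≡ false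
·-zeroʳ Vec.[]      = refl
·-zeroʳ (b Vec.∷ a) = trans (cong (_xor (a · replicate _ false)) (Bool.∧-zeroʳ b)) (·-zeroʳ a)

·-distribˡ-⊕ : (a x u : Vec Bool m) → a · (x ⊕ u) ≡ (a · x) xor (a · u)
·-distribˡ-⊕ Vec.[]      Vec.[]      Vec.[]      = refl
·-distribˡ-⊕ (b Vec.∷ a) (y Vec.∷ x) (v Vec.∷ u) = begin
  (b ∧ (y xor v)) xor (a · (x ⊕ u))
    ≡⟨ cong₂ _xor_ (Bool.∧-distribˡ-xor b y v) (·-distribˡ-⊕ a x u) ⟩
  ((b ∧ y) xor (b ∧ v)) xor ((a · x) xor (a · u))
    ≡⟨ xor-interchange (b ∧ y) (b ∧ v) (a · x) (a · u) ⟩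
  ((b ∧ y) xor (a · x)) xor ((b ∧ v) xor (a · u))
    ∎
  where open ≡-Reasoning

module _ (S : Vec Bool m → Bool)
         (S-closed : ∀ x y → S x ≡ true → S y ≡ true → S (x ⊕ y) ≡ true) where

  translate-invariant : ∀ {u} → S u ≡ true → ∀ x → S (x ⊕ u) ≡ S x
  translate-invariant {u} Su x with S x in Sx | S (x ⊕ u) in Sxu
  ... | true  | true  = refl
  ... | false | false = refl
  ... | true  | false = trans (sym Sxu) (S-closed x u Sx Su)
  ... | false | true  =
    trans (sym (subst (λ y → S y ≡ true) (⊕-cancelʳ x u) (S-closed _ u Sxu Su))) Sx

  ∣S∩ker∣≡∣S∖ker∣ : ∀ a {u} → S u ≡ true → a · u ≡ true →
    ∑[ x ∈ allVecs m ] 𝟙 (S x ∧ not (a · x)) ≡ ∑[ x ∈ allVecs m ] 𝟙 (S x ∧ a · x)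
  ∣S∩ker∣≡∣S∖ker∣ a {u} Su au = trans (∑-translate u _) (∑-cong (allVecs m) swap)
    where
    swap : ∀ x → 𝟙 (S (x ⊕ u) ∧ not (a · (x ⊕ u))) ≡ 𝟙 (S x ∧ a · x)
    swap x rewrite translate-invariant Su x | ·-distribˡ-⊕ a x u | au = cong (λ b → 𝟙 (S x ∧ b))
      (trans (Bool.not-distribʳ-xor (a · x) true) (Bool.xor-identityʳ (a · x)))

  ∣S∩ker∣-cases : ∀ a → let k = ∑[ x ∈ allVecs m ] 𝟙 (S x ∧ not (a · x)) in
    k ≡ ∑[ x ∈ allVecs m ] 𝟙 (S x) ⊎ k + k ≡ ∑[ x ∈ allVecs m ] 𝟙 (S x)
  ∣S∩ker∣-cases a with ∑[ x ∈ allVecs m ] 𝟙 (S x ∧ a · x) in c≡ | count-split (allVecs m) S (a ·_)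
  ... | zero  | S≡k+0 = inj₁ (sym (trans S≡k+0 (+-identityʳ _)))
  ... | suc _ | S≡k+c with ∑-pos⇒∃ (allVecs m) {λ x → 𝟙 (S x ∧ a · x)} (subst (0 <_) (sym c≡) z<s)
  ...   | u , _ , 0<𝟙 = inj₂ (trans (cong (∑[ x ∈ allVecs m ] 𝟙 (S x ∧ not (a · x)) +_)
                                          (trans (∣S∩ker∣≡∣S∖ker∣ a Su au) c≡))
                                    (sym S≡k+c))
    where
    Su∧au : S u ∧ a · u ≡ true
    Su∧au = 0<𝟙⇒true 0<𝟙
    Su : S u ≡ true
    Su = Bool.∧-conicalˡ (S u) (a · u) Su∧au
    au : a · u ≡ true
    au = Bool.∧-conicalʳ (S u) (a · u) Su∧au

∑-allFin-suc : ∀ {n} (f : Fin (suc n) → ℕ) → ∑ (allFin (suc n)) f ≡ f zero + ∑[ i ∈ allFin n ] f (suc i)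
∑-allFin-suc f =
  cong (f zero +_) (cong sum (trans (map-tabulate suc f) (sym (map-tabulate id (f ∘ suc)))))

∣p∣≡∑ : ∀ {n} (p : Subset n) → ∣ p ∣ ≡ ∑[ i ∈ allFin n ] 𝟙 (Vec.lookup p i)
∣p∣≡∑ Vec.[]          = refl
∣p∣≡∑ (true Vec.∷ p)  = trans (cong suc (∣p∣≡∑ p)) (sym (∑-allFin-suc (𝟙 ∘ Vec.lookup (true Vec.∷ p))))
∣p∣≡∑ (false Vec.∷ p) = trans (∣p∣≡∑ p) (sym (∑-allFin-suc (𝟙 ∘ Vec.lookup (false Vec.∷ p))))

∣p∪q∣+∣p∩q∣ : ∀ {n} (p q : Subset n) → ∣ p ∪ q ∣ + ∣ p ∩ q ∣ ≡ ∣ p ∣ + ∣ q ∣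
∣p∪q∣+∣p∩q∣ Vec.[]          Vec.[]          = refl
∣p∪q∣+∣p∩q∣ (true Vec.∷ p)  (true Vec.∷ q)  =
  cong suc (trans (+-suc _ _) (trans (cong suc (∣p∪q∣+∣p∩q∣ p q)) (sym (+-suc _ _))))
∣p∪q∣+∣p∩q∣ (true Vec.∷ p)  (false Vec.∷ q) = cong suc (∣p∪q∣+∣p∩q∣ p q)
∣p∪q∣+∣p∩q∣ (false Vec.∷ p) (true Vec.∷ q)  = trans (cong suc (∣p∪q∣+∣p∩q∣ p q)) (sym (+-suc _ _))
∣p∪q∣+∣p∩q∣ (false Vec.∷ p) (false Vec.∷ q) = ∣p∪q∣+∣p∩q∣ p q

-- The space V = F₂⁶

points : List V
points = allVecs 6

card≡∑ : (S : SubsetV) → card S ≡ ∑[ x ∈ points ] 𝟙 (S x)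
card≡∑ S = countIn≡∑ points
  where
  countIn≡∑ : ∀ xs → countIn S xs ≡ ∑[ x ∈ xs ] 𝟙 (S x)
  countIn≡∑ []       = refl
  countIn≡∑ (x ∷ xs) = cong (𝟙 (S x) +_) (countIn≡∑ xs)

card-∩-all : ∀ S → card (S ∩V (λ _ → true)) ≡ card S
card-∩-all S = trans (card≡∑ (S ∩V (λ _ → true)))
  (trans (∑-cong points (λ x → cong 𝟙 (Bool.∧-identityʳ (S x)))) (sym (card≡∑ S)))

ker : V → SubsetV
ker a x = not (a · x)

card-split : ∀ S T → card S ≡ card (S ∩V (not ∘ T)) + card (S ∩V T)
card-split S T = begin
  card S                                               ≡⟨ card≡∑ S ⟩
  ∑[ x ∈ points ] 𝟙 (S x)                              ≡⟨ count-split points S T ⟩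
  ∑[ x ∈ points ] 𝟙 (S x ∧ not (T x)) + ∑[ x ∈ points ] 𝟙 (S x ∧ T x)
    ≡⟨ cong₂ _+_ (card≡∑ (S ∩V (not ∘ T))) (card≡∑ (S ∩V T)) ⟨
  card (S ∩V (not ∘ T)) + card (S ∩V T)                ∎
  where open ≡-Reasoning

k+k≡2m⇒k≡m : ∀ {k m} → k + k ≡ 2 * m → k ≡ m
k+k≡2m⇒k≡m {k} {m} k+k≡2m = *-cancelˡ-≡ k m 2 (trans (cong (k +_) (+-identityʳ k)) k+k≡2m)

∣ker∣≡32 : ∀ a {q} → a · q ≡ true → card (ker a) ≡ 32
∣ker∣≡32 a aq = k+k≡2m⇒k≡m (begin
  card (ker a) + card (ker a)  ≡⟨ cong (card (ker a) +_) ker≡coker ⟩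
  card (ker a) + card (a ·_)   ≡⟨ card-split (λ _ → true) (a ·_) ⟨
  card (λ _ → true)            ∎)
  where
  open ≡-Reasoning
  ker≡coker : card (ker a) ≡ card (a ·_)
  ker≡coker = trans (card≡∑ (ker a))
    (trans (∣S∩ker∣≡∣S∖ker∣ (λ _ → true) (λ _ _ _ _ → refl) a refl aq) (sym (card≡∑ (a ·_))))

4∣∣S∩ker∣ : ∀ {S} → IsSubspace S → HasDim S 3 → ∀ a → 4 ∣ card (S ∩V ker a)
4∣∣S∩ker∣ {S} (_ , S-closed) S-dim a =
  [ (λ k≡∣S∣   → divides 2 (trans ∣S∩ker∣≡k (trans k≡∣S∣ ∣S∣≡8)))
  , (λ k+k≡∣S∣ → divides 1
      (k+k≡2m⇒k≡m (trans (cong₂ _+_ ∣S∩ker∣≡k ∣S∩ker∣≡k) (trans k+k≡∣S∣ ∣S∣≡8))))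
  ]′ (∣S∩ker∣-cases S S-closed a)
  where
  ∣S∩ker∣≡k : card (S ∩V ker a) ≡ ∑[ x ∈ points ] 𝟙 (S x ∧ not (a · x))
  ∣S∩ker∣≡k = card≡∑ (S ∩V ker a)
  ∣S∣≡8 : ∑[ x ∈ points ] 𝟙 (S x) ≡ 8
  ∣S∣≡8 = trans (sym (card≡∑ S)) S-dim

Separable : V → V → Set
Separable v q = v ≡ 0ᵥ ⊎ q ≡ 0ᵥ ⊎ q ≡ v ⊎ Any (λ a → a · v ≡ false × a · q ≡ true) points

all-separable : All (λ v → All (Separable v) points) points
all-separable = from-yes (all? (λ v → all? (separable? v) points) points)
  where
  separable? : ∀ v q → Dec (Separable v q)
  separable? v q = v ≟ 0ᵥ ⊎-dec q ≟ 0ᵥ ⊎-dec q ≟ v ⊎-dec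
                   any? (λ a → (a · v Bool.≟ false) ×-dec (a · q Bool.≟ true)) points

separating-functional : ∀ {v q : V} → v ≢ 0ᵥ → q ≢ 0ᵥ → q ≢ v →
                        ∃[ a ] a · v ≡ false × a · q ≡ true
separating-functional {v} {q} v≢0 q≢0 q≢v =
  separate (All.lookup (All.lookup all-separable (∈-allVecs v)) (∈-allVecs q))
  where
  separate : Separable v q → ∃[ a ] a · v ≡ false × a · q ≡ true
  separate (inj₁ v≡0)               = contradiction v≡0 v≢0
  separate (inj₂ (inj₁ q≡0))        = contradiction q≡0 q≢0
  separate (inj₂ (inj₂ (inj₁ q≡v))) = contradiction q≡v q≢v
  separate (inj₂ (inj₂ (inj₂ a)))   = satisfied a

nonzero : SubsetV
nonzero x = not (does (x ≟ 0ᵥ))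

nonzero⇒≢0 : ∀ {x} → nonzero x ≡ true → x ≢ 0ᵥ
nonzero⇒≢0 {x} = not-does⇒¬ (x ≟ 0ᵥ)

line : V → SubsetV
line x y = does (y ≟ 0ᵥ) ∨ does (y ≟ x)

x∈line : ∀ x → line x x ≡ true
x∈line x = trans (cong (does (x ≟ 0ᵥ) ∨_) (dec-true (x ≟ x) refl)) (Bool.∨-zeroʳ _)

line-cases : ∀ {x y} → line x y ≡ true → y ≡ 0ᵥ ⊎ y ≡ x
line-cases {x} {y} y∈line with y ≟ 0ᵥ | y ≟ x
... | yes y≡0 | _       = inj₁ y≡0
... | no  _   | yes y≡x = inj₂ y≡x

line-subspace : ∀ x → IsSubspace (line x)
line-subspace x = refl , closed
  where
  closed : ∀ y z → line x y ≡ true → line x z ≡ true → line x (y +ᵥ z) ≡ true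
  closed y z y∈ z∈ with line-cases {x} {y} y∈ | line-cases {x} {z} z∈
  ... | inj₁ refl | inj₁ refl = refl
  ... | inj₁ refl | inj₂ refl =
    subst (λ w → line x w ≡ true) (sym (zipWith-identityˡ Bool.xor-identityˡ x)) (x∈line x)
  ... | inj₂ refl | inj₁ refl =
    subst (λ w → line x w ≡ true) (sym (zipWith-identityʳ Bool.xor-identityʳ x)) (x∈line x)
  ... | inj₂ refl | inj₂ refl = subst (λ w → line x w ≡ true) (sym (⊕-self x)) refl

line-dim : ∀ {x} → x ≢ 0ᵥ → HasDim (line x) 1
line-dim {x} x≢0 = begin
  card (line x)                                   ≡⟨ card≡∑ (line x) ⟩
  ∑[ y ∈ points ] 𝟙 (line x y)                    ≡⟨ ∑-cong points two-points ⟩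
  ∑[ y ∈ points ] (δ 0ᵥ y + δ x y)                ≡⟨ ∑-distrib-+ points (δ 0ᵥ) (δ x) ⟩
  ∑[ y ∈ points ] δ 0ᵥ y + ∑[ y ∈ points ] δ x y  ≡⟨ cong₂ _+_ (∑-δᵥ 0ᵥ) (∑-δᵥ x) ⟩
  2                                               ∎
  where
  open ≡-Reasoning
  two-points : ∀ y → 𝟙 (line x y) ≡ δ 0ᵥ y + δ x y
  two-points y with y ≟ 0ᵥ | y ≟ x
  ... | yes y≡0 | yes y≡x = contradiction (trans (sym y≡x) y≡0) x≢0
  ... | yes _   | no  _   = refl
  ... | no  _   | yes _   = refl
  ... | no  _   | no  _   = refl

10≤d⇒d≡10∧u≡2 : ∀ {d u} → 10 ≤ d → 8 * d + u + 2 ≡ 64 + 2 * d → d ≡ 10 × u ≡ 2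
10≤d⇒d≡10∧u≡2 {d} {u} 10≤d balance =
  d≡10 , +-cancelˡ-≡ 60 u 2 (subst (λ d → 6 * d + u ≡ 62) d≡10 6d+u≡62)
  where
  regroup : ∀ d u → 8 * d + u + 2 ≡ 2 * d + (6 * d + u) + 2
  regroup = solve-∀
  6d+u≡62 : 6 * d + u ≡ 62
  6d+u≡62 = +-cancelˡ-≡ (2 * d) _ _ (+-cancelʳ-≡ 2 _ _ (begin
    2 * d + (6 * d + u) + 2  ≡⟨ regroup d u ⟨
    8 * d + u + 2            ≡⟨ balance ⟩
    64 + 2 * d               ≡⟨ +-comm 64 (2 * d) ⟩
    2 * d + 64               ≡⟨ +-assoc (2 * d) 62 2 ⟨
    2 * d + 62 + 2           ∎))
    where open ≡-Reasoning
  d≡10 : d ≡ 10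
  d≡10 = ≤-antisym (≮⇒≥ λ 10<d → from-no (66 ≤? 62)
    (≤-trans (*-monoʳ-≤ 6 10<d) (subst (6 * d ≤_) 6d+u≡62 (m≤m+n (6 * d) u)))) 10≤d

4∣s⇒s+z+2≢52 : ∀ {s z} → 4 ∣ s → s + z + 2 ≡ 52 → z ≤ 1 → ⊥
4∣s⇒s+z+2≢52 {s} {0} 4∣s eq _ =
  from-no (4 ∣? 50) (subst (4 ∣_) (trans (sym (+-identityʳ s)) (+-cancelʳ-≡ 2 (s + 0) 50 eq)) 4∣s)
4∣s⇒s+z+2≢52 {s} {1} 4∣s eq _ =
  from-no (4 ∣? 49) (subst (4 ∣_) (+-cancelʳ-≡ 1 s 49 (+-cancelʳ-≡ 2 (s + 1) 50 eq)) 4∣s)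
4∣s⇒s+z+2≢52 {z = suc (suc _)} _ _ (s≤s ())

74≤n⇒n<9h : ∀ {n h} → 74 ≤ n → 7 * n ≤ 8 * 63 + h → n < 9 * h
74≤n⇒n<9h {n} {h} 74≤n 7n≤504+h = ≰⇒> λ 9h≤n →
  from-no (62 * 74 ≤? 4536) (≤-trans (*-monoʳ-≤ 62 74≤n) (62n≤4536 9h≤n))
  where
  regroup : ∀ n → 62 * n + n ≡ 9 * (7 * n)
  regroup = solve-∀
  62n≤4536 : 9 * h ≤ n → 62 * n ≤ 4536
  62n≤4536 9h≤n = +-cancelʳ-≤ n (62 * n) 4536 (begin
    62 * n + n     ≡⟨ regroup n ⟩
    9 * (7 * n)    ≤⟨ *-monoʳ-≤ 9 7n≤504+h ⟩
    9 * (504 + h)  ≡⟨ *-distribˡ-+ 9 504 h ⟩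
    4536 + 9 * h   ≤⟨ +-monoʳ-≤ 4536 9h≤n ⟩
    4536 + n       ∎)
    where open ≤-Reasoning

balance-on-line : ∀ {k c d} → k ≡ true → c ≡ d → 𝟙 k * c + 0 + 1 ≡ 𝟙 k + d * 1
balance-on-line {d = d} refl refl = regroup d
  where
  regroup : ∀ d → 1 * d + 0 + 1 ≡ 1 + d * 1
  regroup = solve-∀

balance-off-line : ∀ k {c} → c ≤ 1 → 𝟙 k * c + 𝟙 (does (c ℕ.≟ 0) ∧ k) ≡ 𝟙 k
balance-off-line true  {0} _ = refl
balance-off-line false {0} _ = refl
balance-off-line true  {1} _ = refl
balance-off-line false {1} _ = refl
balance-off-line _ {suc (suc _)} (s≤s ())

≤9⇒≤8+[≡9] : ∀ {d} → d ≤ 9 → d ≤ 8 + 𝟙 (does (d ℕ.≟ 9))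
≤9⇒≤8+[≡9] {d} d≤9 with d ℕ.≟ 9
... | yes refl = ≤-refl
... | no  d≢9  = ≤-trans (≤-pred (≤∧≢⇒< d≤9 d≢9)) (m≤m+n 8 _)

-- Planes of V pairwise meeting in at most a point

module Collection {n : ℕ} (C : Fin n → SubsetV)
  (C-plane : ∀ i → IsSubspace (C i) × HasDim (C i) 3)
  (C-meet : ∀ i j → i ≢ j → ∃[ d ] (d ≤ 1 × HasDim (C i ∩V C j) d)) where

  members : List (Fin n)
  members = allFin n

  0∈C : ∀ i → C i 0ᵥ ≡ true
  0∈C i = proj₁ (proj₁ (C-plane i))

  two-points-one-member : ∀ {a b i j} → a ≢ 0ᵥ → b ≢ 0ᵥ → a ≢ b →
    C i a ∧ C i b ≡ true → C j a ∧ C j b ≡ true → i ≡ j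
  two-points-one-member {a} {b} {i} {j} a≢0 b≢0 a≢b ab∈Ci ab∈Cj =
    decidable-stable (i Fin.≟ j) λ i≢j → let d , d≤1 , ∣Ci∩Cj∣≡2^d = C-meet i j i≢j in
      3≰2 (begin
        3                                         ≡⟨ three-deltas ⟨
        ∑[ x ∈ points ] (δ 0ᵥ x + δ a x + δ b x)  ≤⟨ ∑-mono-≤ points three-points ⟩
        ∑[ x ∈ points ] 𝟙 (C i x ∧ C j x)         ≡⟨ card≡∑ (C i ∩V C j) ⟨
        card (C i ∩V C j)                         ≡⟨ ∣Ci∩Cj∣≡2^d ⟩
        2 ^ d                                     ≤⟨ ^-monoʳ-≤ 2 d≤1 ⟩
        2                                         ∎)
    where
    open ≤-Reasoning
    3≰2 : ¬ 3 ≤ 2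
    3≰2 (s≤s (s≤s ()))
    three-deltas : ∑[ x ∈ points ] (δ 0ᵥ x + δ a x + δ b x) ≡ 3
    three-deltas = trans (∑-distrib-+ points (λ x → δ 0ᵥ x + δ a x) (δ b))
      (cong₂ _+_ (trans (∑-distrib-+ points (δ 0ᵥ) (δ a)) (cong₂ _+_ (∑-δᵥ 0ᵥ) (∑-δᵥ a))) (∑-δᵥ b))
    three-points : ∀ x → δ 0ᵥ x + δ a x + δ b x ≤ 𝟙 (C i x ∧ C j x)
    three-points x with x ≟ 0ᵥ | x ≟ a | x ≟ b
    ... | yes x≡0  | yes x≡a  | _        = contradiction (trans (sym x≡a) x≡0) a≢0
    ... | yes x≡0  | _        | yes x≡b  = contradiction (trans (sym x≡b) x≡0) b≢0
    ... | _        | yes x≡a  | yes x≡b  = contradiction (trans (sym x≡a) x≡b) a≢b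
    ... | yes refl | no _     | no _     = true⇒0<𝟙 (cong₂ _∧_ (0∈C i) (0∈C j))
    ... | no _     | yes refl | no _     = true⇒0<𝟙
      (cong₂ _∧_ (Bool.∧-conicalˡ (C i a) (C i b) ab∈Ci) (Bool.∧-conicalˡ (C j a) (C j b) ab∈Cj))
    ... | no _     | no _     | yes refl = true⇒0<𝟙
      (cong₂ _∧_ (Bool.∧-conicalʳ (C i a) (C i b) ab∈Ci) (Bool.∧-conicalʳ (C j a) (C j b) ab∈Cj))
    ... | no _     | no _     | no _     = z≤n

  deg : V → ℕ
  deg x = ∑[ i ∈ members ] 𝟙 (C i x)

  codeg : V → V → ℕ
  codeg v x = ∑[ i ∈ members ] 𝟙 (C i v ∧ C i x)

  ∑-incidences : ∀ (W : Fin n → Bool) (K : SubsetV) →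
    ∑[ x ∈ points ] (𝟙 (K x) * ∑[ i ∈ members ] 𝟙 (W i ∧ C i x))
      ≡ ∑[ i ∈ members ] (𝟙 (W i) * card (C i ∩V K))
  ∑-incidences W K = begin
    ∑[ x ∈ points ] (𝟙 (K x) * ∑[ i ∈ members ] 𝟙 (W i ∧ C i x))
      ≡⟨ ∑-cong points (λ x → ∑-distribˡ-* (𝟙 (K x)) members (λ i → 𝟙 (W i ∧ C i x))) ⟨
    ∑[ x ∈ points ] ∑[ i ∈ members ] (𝟙 (K x) * 𝟙 (W i ∧ C i x))
      ≡⟨ ∑-comm points members (λ x i → 𝟙 (K x) * 𝟙 (W i ∧ C i x)) ⟩
    ∑[ i ∈ members ] ∑[ x ∈ points ] (𝟙 (K x) * 𝟙 (W i ∧ C i x))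
      ≡⟨ ∑-cong members (λ i → ∑-cong points (rotate i)) ⟩
    ∑[ i ∈ members ] ∑[ x ∈ points ] (𝟙 (W i) * 𝟙 (C i x ∧ K x))
      ≡⟨ ∑-cong members (λ i → ∑-distribˡ-* (𝟙 (W i)) points (λ x → 𝟙 (C i x ∧ K x))) ⟩
    ∑[ i ∈ members ] (𝟙 (W i) * ∑[ x ∈ points ] 𝟙 (C i x ∧ K x))
      ≡⟨ ∑-cong members (λ i → cong (𝟙 (W i) *_) (card≡∑ (C i ∩V K))) ⟨
    ∑[ i ∈ members ] (𝟙 (W i) * card (C i ∩V K))
      ∎
    where
    open ≡-Reasoning
    rotate : ∀ i x → 𝟙 (K x) * 𝟙 (W i ∧ C i x) ≡ 𝟙 (W i) * 𝟙 (C i x ∧ K x)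
    rotate i x = begin
      𝟙 (K x) * 𝟙 (W i ∧ C i x)  ≡⟨ 𝟙-∧ (K x) (W i ∧ C i x) ⟨
      𝟙 (K x ∧ (W i ∧ C i x))    ≡⟨ cong 𝟙 (Bool.∧-comm (K x) (W i ∧ C i x)) ⟩
      𝟙 ((W i ∧ C i x) ∧ K x)    ≡⟨ cong 𝟙 (Bool.∧-assoc (W i) (C i x) (K x)) ⟩
      𝟙 (W i ∧ (C i x ∧ K x))    ≡⟨ 𝟙-∧ (W i) (C i x ∧ K x) ⟩
      𝟙 (W i) * 𝟙 (C i x ∧ K x)  ∎

  module _ {v : V} (v≢0 : v ≢ 0ᵥ) where

    codeg-origin : codeg v 0ᵥ ≡ deg v
    codeg-origin = ∑-cong members λ i →
      cong 𝟙 (trans (cong (C i v ∧_) (0∈C i)) (Bool.∧-identityʳ (C i v)))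

    codeg-self : codeg v v ≡ deg v
    codeg-self = ∑-cong members λ i → cong 𝟙 (Bool.∧-idem (C i v))

    codeg≤1 : ∀ {x} → x ≢ 0ᵥ → x ≢ v → codeg v x ≤ 1
    codeg≤1 {x} x≢0 x≢v =
      count≤1 (λ i → C i v ∧ C i x) (Unique.allFin⁺ n) (two-points-one-member v≢0 x≢0 (x≢v ∘ sym))

    uncovered : SubsetV
    uncovered x = nonzero x ∧ not (does (x ≟ v)) ∧ does (codeg v x ℕ.≟ 0)

    uncovered⇒≢0 : ∀ {x} → uncovered x ≡ true → x ≢ 0ᵥ
    uncovered⇒≢0 {x} x∈U = nonzero⇒≢0 (Bool.∧-conicalˡ (nonzero x) _ x∈U)

    uncovered⇒≢v : ∀ {x} → uncovered x ≡ true → x ≢ v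
    uncovered⇒≢v {x} x∈U = not-does⇒¬ (x ≟ v)
      (Bool.∧-conicalˡ (not (does (x ≟ v))) _ (Bool.∧-conicalʳ (nonzero x) _ x∈U))

    balance-at : ∀ (K : SubsetV) → K 0ᵥ ≡ true → K v ≡ true → ∀ x →
      𝟙 (K x) * codeg v x + 𝟙 (uncovered x ∧ K x) + (δ 0ᵥ x + δ v x)
        ≡ 𝟙 (K x) + deg v * (δ 0ᵥ x + δ v x)
    balance-at K K0 Kv x with x ≟ 0ᵥ | x ≟ v
    ... | yes x≡0  | yes x≡v  = contradiction (trans (sym x≡v) x≡0) v≢0
    ... | yes refl | no _     = balance-on-line K0 codeg-origin
    ... | no _     | yes refl = balance-on-line Kv codeg-self
    ... | no x≢0   | no x≢v   =
      cong₂ _+_ (balance-off-line (K x) (codeg≤1 x≢0 x≢v)) (sym (*-zeroʳ (deg v)))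

    balance : ∀ (K : SubsetV) → K 0ᵥ ≡ true → K v ≡ true →
      ∑[ x ∈ points ] (𝟙 (K x) * codeg v x) + card (uncovered ∩V K) + 2 ≡ card K + 2 * deg v
    balance K K0 Kv = begin
      ∑[ x ∈ points ] (𝟙 (K x) * codeg v x) + card (uncovered ∩V K) + 2
        ≡⟨ cong₂ (λ u l → ∑[ x ∈ points ] (𝟙 (K x) * codeg v x) + u + l)
                 (card≡∑ (uncovered ∩V K)) line-size ⟨
      ∑[ x ∈ points ] (𝟙 (K x) * codeg v x) + ∑[ x ∈ points ] 𝟙 (uncovered x ∧ K x)
        + ∑[ x ∈ points ] (δ 0ᵥ x + δ v x)
        ≡⟨ cong (_+ ∑[ x ∈ points ] (δ 0ᵥ x + δ v x))
                (∑-distrib-+ points (λ x → 𝟙 (K x) * codeg v x) (λ x → 𝟙 (uncovered x ∧ K x))) ⟨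
      ∑[ x ∈ points ] (𝟙 (K x) * codeg v x + 𝟙 (uncovered x ∧ K x))
        + ∑[ x ∈ points ] (δ 0ᵥ x + δ v x)
        ≡⟨ ∑-distrib-+ points (λ x → 𝟙 (K x) * codeg v x + 𝟙 (uncovered x ∧ K x))
                              (λ x → δ 0ᵥ x + δ v x) ⟨
      ∑[ x ∈ points ] (𝟙 (K x) * codeg v x + 𝟙 (uncovered x ∧ K x) + (δ 0ᵥ x + δ v x))
        ≡⟨ ∑-cong points (balance-at K K0 Kv) ⟩
      ∑[ x ∈ points ] (𝟙 (K x) + deg v * (δ 0ᵥ x + δ v x))
        ≡⟨ ∑-distrib-+ points (λ x → 𝟙 (K x)) (λ x → deg v * (δ 0ᵥ x + δ v x)) ⟩
      ∑[ x ∈ points ] 𝟙 (K x) + ∑[ x ∈ points ] (deg v * (δ 0ᵥ x + δ v x))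
        ≡⟨ cong₂ _+_ (sym (card≡∑ K)) (∑-distribˡ-* (deg v) points (λ x → δ 0ᵥ x + δ v x)) ⟩
      card K + deg v * ∑[ x ∈ points ] (δ 0ᵥ x + δ v x)
        ≡⟨ cong (λ l → card K + deg v * l) line-size ⟩
      card K + deg v * 2
        ≡⟨ cong (card K +_) (*-comm (deg v) 2) ⟩
      card K + 2 * deg v
        ∎
      where
      open ≡-Reasoning
      line-size : ∑[ x ∈ points ] (δ 0ᵥ x + δ v x) ≡ 2
      line-size = trans (∑-distrib-+ points (δ 0ᵥ) (δ v)) (cong₂ _+_ (∑-δᵥ 0ᵥ) (∑-δᵥ v))

    degree-balance : 8 * deg v + card uncovered + 2 ≡ 64 + 2 * deg v
    degree-balance = begin
      8 * deg v + card uncovered + 2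
        ≡⟨ cong₂ (λ s u → s + u + 2) ∑codeg≡8deg (card-∩-all uncovered) ⟨
      ∑[ x ∈ points ] (𝟙 true * codeg v x) + card (uncovered ∩V (λ _ → true)) + 2
        ≡⟨ balance (λ _ → true) refl refl ⟩
      64 + 2 * deg v
        ∎
      where
      open ≡-Reasoning
      ∑codeg≡8deg : ∑[ x ∈ points ] (𝟙 true * codeg v x) ≡ 8 * deg v
      ∑codeg≡8deg = begin
        ∑[ x ∈ points ] (𝟙 true * codeg v x)
          ≡⟨ ∑-incidences (λ i → C i v) (λ _ → true) ⟩
        ∑[ i ∈ members ] (𝟙 (C i v) * card (C i ∩V (λ _ → true)))
          ≡⟨ ∑-cong members (λ i → cong (𝟙 (C i v) *_) (trans (card-∩-all (C i)) (proj₂ (C-plane i)))) ⟩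
        ∑[ i ∈ members ] (𝟙 (C i v) * 8)
          ≡⟨ ∑-cong members (λ i → *-comm (𝟙 (C i v)) 8) ⟩
        ∑[ i ∈ members ] (8 * 𝟙 (C i v))
          ≡⟨ ∑-distribˡ-* 8 members (λ i → 𝟙 (C i v)) ⟩
        8 * deg v
          ∎

    hyperplane-balance : ∀ {a q} → deg v ≡ 10 → a · v ≡ false → a · q ≡ true →
      ∑[ x ∈ points ] (𝟙 (ker a x) * codeg v x) + card (uncovered ∩V ker a) + 2 ≡ 52
    hyperplane-balance {a} deg≡10 av aq =
      trans (balance (ker a) (cong not (·-zeroʳ a)) (cong not av))
            (cong₂ (λ k d → k + 2 * d) (∣ker∣≡32 a aq) deg≡10)

    4∣∑codeg-ker : ∀ a → 4 ∣ ∑[ x ∈ points ] (𝟙 (ker a x) * codeg v x)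
    4∣∑codeg-ker a = subst (4 ∣_) (sym (∑-incidences (λ i → C i v) (ker a)))
      (∑-∣ members (λ i → 𝟙 (C i v) * card (C i ∩V ker a))
        (λ i → ∣n⇒∣m*n (𝟙 (C i v)) (4∣∣S∩ker∣ (proj₁ (C-plane i)) (proj₂ (C-plane i)) a)))

    ∣U∩ker∣≤1 : card uncovered ≡ 2 → ∀ a {q} → uncovered q ≡ true → a · q ≡ true →
      card (uncovered ∩V ker a) ≤ 1
    ∣U∩ker∣≤1 ∣U∣≡2 a {q} q∈U aq = +-cancelʳ-≤ 1 (card (uncovered ∩V ker a)) 1 (begin
      card (uncovered ∩V ker a) + 1
        ≤⟨ +-monoʳ-≤ (card (uncovered ∩V ker a)) 1≤∣U∖ker∣ ⟩
      card (uncovered ∩V ker a) + card (uncovered ∩V (a ·_))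
        ≡⟨ card-split uncovered (a ·_) ⟨
      card uncovered
        ≡⟨ ∣U∣≡2 ⟩
      2 ∎)
      where
      open ≤-Reasoning
      1≤∣U∖ker∣ : 1 ≤ card (uncovered ∩V (a ·_))
      1≤∣U∖ker∣ = subst (1 ≤_) (sym (card≡∑ (uncovered ∩V (a ·_))))
        (≤-trans (true⇒0<𝟙 (cong₂ _∧_ q∈U aq)) (∈⇒≤∑ (λ x → 𝟙 (uncovered x ∧ a · x)) (∈-allVecs q)))

    separated-uncovered-impossible : deg v ≡ 10 → card uncovered ≡ 2 →
      ∀ {q} → uncovered q ≡ true → ¬ (∃[ a ] a · v ≡ false × a · q ≡ true)
    separated-uncovered-impossible deg≡10 ∣U∣≡2 {q} q∈U (a , av , aq) = 4∣s⇒s+z+2≢52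
      (4∣∑codeg-ker a) (hyperplane-balance {a} {q} deg≡10 av aq) (∣U∩ker∣≤1 ∣U∣≡2 a q∈U aq)

    uncovered-impossible : deg v ≡ 10 → card uncovered ≡ 2 →
      ¬ (∃[ q ] q ∈ points × 0 < 𝟙 (uncovered q))
    uncovered-impossible deg≡10 ∣U∣≡2 (q , _ , 0<𝟙Uq) =
      separated-uncovered-impossible deg≡10 ∣U∣≡2 q∈U
        (separating-functional v≢0 (uncovered⇒≢0 {q} q∈U) (uncovered⇒≢v {q} q∈U))
      where
      q∈U : uncovered q ≡ true
      q∈U = 0<𝟙⇒true 0<𝟙Uq

    deg≤9 : deg v ≤ 9
    deg≤9 = ≮⇒≥ λ 10≤deg → let deg≡10 , ∣U∣≡2 = 10≤d⇒d≡10∧u≡2 10≤deg degree-balance in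
      uncovered-impossible deg≡10 ∣U∣≡2
        (∑-pos⇒∃ points (subst (0 <_) (trans (sym ∣U∣≡2) (card≡∑ uncovered)) z<s))

  heavy : SubsetV
  heavy x = nonzero x ∧ does (deg x ℕ.≟ 9)

  heavy⇒≢0 : ∀ {x} → heavy x ≡ true → x ≢ 0ᵥ
  heavy⇒≢0 {x} h = nonzero⇒≢0 (Bool.∧-conicalˡ (nonzero x) (does (deg x ℕ.≟ 9)) h)

  heavy⇒deg≡9 : ∀ {x} → heavy x ≡ true → deg x ≡ 9
  heavy⇒deg≡9 {x} h = does⇒ (deg x ℕ.≟ 9) (Bool.∧-conicalʳ (nonzero x) (does (deg x ℕ.≟ 9)) h)

  ∣C∩nonzero∣≡7 : ∀ i → card (C i ∩V nonzero) ≡ 7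
  ∣C∩nonzero∣≡7 i = +-cancelʳ-≡ 1 (card (C i ∩V nonzero)) 7 (begin
    card (C i ∩V nonzero) + 1
      ≡⟨ cong (card (C i ∩V nonzero) +_) ∣C∩0∣≡1 ⟨
    card (C i ∩V nonzero) + card (C i ∩V λ x → does (x ≟ 0ᵥ))
      ≡⟨ card-split (C i) (λ x → does (x ≟ 0ᵥ)) ⟨
    card (C i)
      ≡⟨ proj₂ (C-plane i) ⟩
    8 ∎)
    where
    open ≡-Reasoning
    origin : ∀ x → 𝟙 (C i x ∧ does (x ≟ 0ᵥ)) ≡ δ 0ᵥ x
    origin x with x ≟ 0ᵥ
    ... | yes refl = cong 𝟙 (trans (Bool.∧-identityʳ (C i 0ᵥ)) (0∈C i))
    ... | no  _    = cong 𝟙 (Bool.∧-zeroʳ (C i x))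
    ∣C∩0∣≡1 : card (C i ∩V λ x → does (x ≟ 0ᵥ)) ≡ 1
    ∣C∩0∣≡1 = trans (card≡∑ (C i ∩V λ x → does (x ≟ 0ᵥ))) (trans (∑-cong points origin) (∑-δᵥ 0ᵥ))

  ∣nonzero∣≡63 : ∑[ x ∈ points ] 𝟙 (nonzero x) ≡ 63
  ∣nonzero∣≡63 = refl

  ∑1≡n : ∑[ i ∈ members ] 1 ≡ n
  ∑1≡n = trans (∑-const members 1) (trans (*-identityʳ _) (length-tabulate id))

  7n≤504+∣heavy∣ : 7 * n ≤ 8 * 63 + card heavy
  7n≤504+∣heavy∣ = begin
    7 * n
      ≡⟨ cong (7 *_) ∑1≡n ⟨
    7 * ∑[ i ∈ members ] 1
      ≡⟨ ∑-distribˡ-* 7 members (λ _ → 1) ⟨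
    ∑[ i ∈ members ] 7
      ≡⟨ ∑-cong members (λ i → cong (1 *_) (∣C∩nonzero∣≡7 i)) ⟨
    ∑[ i ∈ members ] (𝟙 true * card (C i ∩V nonzero))
      ≡⟨ ∑-incidences (λ _ → true) nonzero ⟨
    ∑[ x ∈ points ] (𝟙 (nonzero x) * deg x)
      ≤⟨ ∑-mono-≤ points deg-bound ⟩
    ∑[ x ∈ points ] (8 * 𝟙 (nonzero x) + 𝟙 (heavy x))
      ≡⟨ ∑-distrib-+ points (λ x → 8 * 𝟙 (nonzero x)) (λ x → 𝟙 (heavy x)) ⟩
    ∑[ x ∈ points ] (8 * 𝟙 (nonzero x)) + ∑[ x ∈ points ] 𝟙 (heavy x)
      ≡⟨ cong₂ _+_ (trans (∑-distribˡ-* 8 points (λ x → 𝟙 (nonzero x))) (cong (8 *_) ∣nonzero∣≡63))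
                   (sym (card≡∑ heavy)) ⟩
    8 * 63 + card heavy
      ∎
    where
    open ≤-Reasoning
    deg-bound : ∀ x → 𝟙 (nonzero x) * deg x ≤ 8 * 𝟙 (nonzero x) + 𝟙 (heavy x)
    deg-bound x with x ≟ 0ᵥ
    ... | yes _   = z≤n
    ... | no  x≢0 = ≤-trans (≤-reflexive (*-identityˡ (deg x))) (≤9⇒≤8+[≡9] (deg≤9 x≢0))

  9∣heavy∣≡∑∣C∩heavy∣ : 9 * card heavy ≡ ∑[ i ∈ members ] card (C i ∩V heavy)
  9∣heavy∣≡∑∣C∩heavy∣ = begin
    9 * card heavy
      ≡⟨ cong (9 *_) (card≡∑ heavy) ⟩
    9 * ∑[ x ∈ points ] 𝟙 (heavy x)
      ≡⟨ ∑-distribˡ-* 9 points (λ x → 𝟙 (heavy x)) ⟨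
    ∑[ x ∈ points ] (9 * 𝟙 (heavy x))
      ≡⟨ ∑-cong points (λ x → trans (*-comm 9 (𝟙 (heavy x))) (𝟙-*-cong (heavy x) (sym ∘ heavy⇒deg≡9))) ⟩
    ∑[ x ∈ points ] (𝟙 (heavy x) * deg x)
      ≡⟨ ∑-incidences (λ _ → true) heavy ⟩
    ∑[ i ∈ members ] (𝟙 true * card (C i ∩V heavy))
      ≡⟨ ∑-cong members (λ i → *-identityˡ (card (C i ∩V heavy))) ⟩
    ∑[ i ∈ members ] card (C i ∩V heavy)
      ∎
    where open ≡-Reasoning

  SharedHeavyPair : Set
  SharedHeavyPair = ∃[ i ] ∃₂ λ x y → x ≢ y × C i x ∧ heavy x ≡ true × C i y ∧ heavy y ≡ true

  shared-heavy-pair : 74 ≤ n → SharedHeavyPair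
  shared-heavy-pair 74≤n = pair (∑-<⇒∃ members {λ _ → 1} {λ i → card (C i ∩V heavy)} n<∑)
    where
    n<∑ : ∑[ i ∈ members ] 1 < ∑[ i ∈ members ] card (C i ∩V heavy)
    n<∑ = subst₂ _<_ (sym ∑1≡n) 9∣heavy∣≡∑∣C∩heavy∣ (74≤n⇒n<9h 74≤n 7n≤504+∣heavy∣)
    pair : ∃[ i ] 1 < card (C i ∩V heavy) → SharedHeavyPair
    pair (i , 1<∣Ci∩heavy∣) = i , 1<count⇒pair (λ x → C i x ∧ heavy x) (allVecs⁺ 6)
      (subst (1 <_) (card≡∑ (C i ∩V heavy)) 1<∣Ci∩heavy∣)

  star : V → Subset n
  star x = Vec.tabulate (λ i → C i x)

  ∣star∣≡deg : ∀ x → ∣ star x ∣ ≡ deg x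
  ∣star∣≡deg x = trans (∣p∣≡∑ (star x)) (∑-cong members λ i → cong 𝟙 (lookup∘tabulate (λ j → C j x) i))

  ∣star∩star∣ : ∀ x y → ∣ star x ∩ star y ∣ ≡ ∑[ i ∈ members ] 𝟙 (C i x ∧ C i y)
  ∣star∩star∣ x y = trans (∣p∣≡∑ (star x ∩ star y)) (∑-cong members λ i → cong 𝟙 (begin
    Vec.lookup (star x ∩ star y) i                 ≡⟨ lookup-zipWith _∧_ i (star x) (star y) ⟩
    Vec.lookup (star x) i ∧ Vec.lookup (star y) i  ≡⟨ cong₂ _∧_ (lookup∘tabulate (λ j → C j x) i)
                                                                (lookup∘tabulate (λ j → C j y) i) ⟩
    C i x ∧ C i y                                  ∎))
    where open ≡-Reasoning

  ∣star∣≡9 : ∀ {x} → heavy x ≡ true → ∣ star x ∣ ≡ 9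
  ∣star∣≡9 {x} x-heavy = trans (∣star∣≡deg x) (heavy⇒deg≡9 x-heavy)

  star-nine : ∀ {x} → heavy x ≡ true → NineConfig C (star x)
  star-nine {x} x-heavy = ∣star∣≡9 x-heavy ,
    line x , line-subspace x , line-dim (heavy⇒≢0 x-heavy) , line⊆C
    where
    line⊆C : ∀ i → i ∈ₛ star x → line x ⊆V C i
    line⊆C i i∈star y y∈line with line-cases {x} {y} y∈line
    ... | inj₁ refl = 0∈C i
    ... | inj₂ refl = trans (sym (lookup∘tabulate (λ j → C j x) i)) ([]=⇒lookup i∈star)

  seventeen-config : SharedHeavyPair → SeventeenConfig C
  seventeen-config (i , x , y , x≢y , x∈Ci , y∈Ci) =
    star x , star y , star-nine x-heavy , star-nine y-heavy , ∣star∪star∣≡17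
    where
    x-heavy : heavy x ≡ true
    x-heavy = Bool.∧-conicalʳ (C i x) (heavy x) x∈Ci
    y-heavy : heavy y ≡ true
    y-heavy = Bool.∧-conicalʳ (C i y) (heavy y) y∈Ci
    ∣star∩star∣≡1 : ∣ star x ∩ star y ∣ ≡ 1
    ∣star∩star∣≡1 = trans (∣star∩star∣ x y) (≤-antisym
      (count≤1 (λ j → C j x ∧ C j y) (Unique.allFin⁺ n)
               (two-points-one-member (heavy⇒≢0 x-heavy) (heavy⇒≢0 y-heavy) x≢y))
      (≤-trans (true⇒0<𝟙 (cong₂ _∧_ (Bool.∧-conicalˡ (C i x) (heavy x) x∈Ci)
                                     (Bool.∧-conicalˡ (C i y) (heavy y) y∈Ci)))
               (∈⇒≤∑ (λ j → 𝟙 (C j x ∧ C j y)) (∈-allFin i))))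
    ∣star∪star∣≡17 : ∣ star x ∪ star y ∣ ≡ 17
    ∣star∪star∣≡17 = +-cancelʳ-≡ 1 ∣ star x ∪ star y ∣ 17 (begin
      ∣ star x ∪ star y ∣ + 1                    ≡⟨ cong (∣ star x ∪ star y ∣ +_) ∣star∩star∣≡1 ⟨
      ∣ star x ∪ star y ∣ + ∣ star x ∩ star y ∣  ≡⟨ ∣p∪q∣+∣p∩q∣ (star x) (star y) ⟩
      ∣ star x ∣ + ∣ star y ∣                    ≡⟨ cong₂ _+_ (∣star∣≡9 x-heavy) (∣star∣≡9 y-heavy) ⟩
      18                                         ∎)
      where open ≡-Reasoning

-- Distinctness of the members (third hypothesis) already follows from the bound on intersections.
lemma8 : (n : ℕ) (C : Fin n → SubsetV) →
    (∀ i → IsSubspace (C i) × HasDim (C i) 3) →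
    (∀ i j → ¬ i ≡ j → ¬ (∀ v → C i v ≡ C j v)) →
    (∀ i j → ¬ i ≡ j → ∃[ d ] (d ≤ 1 × HasDim (C i ∩V C j) d)) →
    74 ≤ n →
    SeventeenConfig C
lemma8 n C C-plane _ C-meet 74≤n = seventeen-config (shared-heavy-pair 74≤n)
  where open Collection C C-plane C-meet
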